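{- Let $n\ge1$ and $\sigma\in C_{2n}(123)$, and write $w(\sigma)=x_1\,w_1\,x_2\,w_2\cdots x_s\,w_s$ as in the context. Then for every $i=1,\dots,s$, $$x_i\ge m(A_{i-1}).$$
   Context: $C_{2n}(123)$ is the set of permutations $\sigma$ of $[2n]=\{1,\dots,2n\}$ that are centrosymmetric ($\sigma(i)+\sigma(2n+1-i)=2n+1$ for all $i$) and avoid $123$ (no $i<j<k$ with $\sigma(i)<\sigma(j)<\sigma(k)$). Let $w(\sigma)=\sigma(1)\cdots\sigma(n)$. A left-to-right minimum of $\sigma$ is a position $i$ with $\sigma(i)\le\sigma(j)$ for all $j\le i$. Write $w(\sigma)=x_1w_1\cdots x_sw_s$, where $x_1,\dots,x_s$ are the values of the left-to-right minima of $\sigma$ among the first $n$ positions, and $w_i$ is the (possibly empty) word of entries between $x_i$ and $x_{i+1}$ (or between $x_s$ and the end of $w(\sigma)$). Define alphabets $A_0=[2n]$ and, for $i\ge1$, $A_i$ obtained from $A_{i-1}$ by removing $x_i$, $2n+1-x_i$, the entries of $w_i$, and the complements $2n+1-a$ of the entries $a$ of $w_i$. For a set $A=\{s_1<s_2<\dots<s_{2h}\}$ of even size, its middle element is $m(A)=s_h$. -}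

module Defs where

open import Data.Nat using (ℕ; zero; suc; _+_; _*_; _∸_; _≤_; _<_; _≡ᵇ_; _/_)
open import Data.Bool using (Bool; true; false; not; _∨_)
open import Data.List using (List; []; _∷_; map; filterᵇ; length; upTo)
open import Data.Bool.ListAction using (any)
open import Data.Product using (_×_)
open import Relation.Binary.PropositionalEquality using (_≡_)
open import Relation.Nullary using (¬_)

-- Permutations of [2n] = {1,…,2n} are modelled as functions σ : ℕ → ℕ
-- whose restriction to [2n] is a bijection [2n] → [2n]
-- (values outside [2n] are irrelevant).

IsPerm : ℕ → (ℕ → ℕ) → Set
IsPerm n σ =
  (∀ i → 1 ≤ i → i ≤ 2 * n → 1 ≤ σ i × σ i ≤ 2 * n) ×
  (∀ i j → 1 ≤ i → i ≤ 2 * n → 1 ≤ j → j ≤ 2 * n → σ i ≡ σ j → i ≡ j)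

Centrosymmetric : ℕ → (ℕ → ℕ) → Set
Centrosymmetric n σ = ∀ i → 1 ≤ i → i ≤ 2 * n → σ i + σ (suc (2 * n) ∸ i) ≡ suc (2 * n)

Avoids123 : ℕ → (ℕ → ℕ) → Set
Avoids123 n σ = ∀ i j k → 1 ≤ i → i < j → j < k → k ≤ 2 * n →
  ¬ (σ i < σ j × σ j < σ k)

InC123 : ℕ → (ℕ → ℕ) → Set
InC123 n σ = IsPerm n σ × Centrosymmetric n σ × Avoids123 n σ

IsLRMin : (ℕ → ℕ) → ℕ → Set
IsLRMin σ i = ∀ j → 1 ≤ j → j ≤ i → σ i ≤ σ j

range1 : ℕ → List ℕ
range1 m = map suc (upTo m)

removedBefore : ℕ → (ℕ → ℕ) → ℕ → ℕ → Bool
removedBefore n σ p a =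
  any (λ j → (σ j ≡ᵇ a) ∨ ((suc (2 * n) ∸ σ j) ≡ᵇ a)) (range1 (p ∸ 1))

-- The alphabet A_{i-1} attached to the i-th left-to-right minimum x_i = σ(p)
-- located at position p: [2n] with σ(j) and 2n+1-σ(j) removed for every
-- position j < p (these are exactly the letters x_1,w_1,…,x_{i-1},w_{i-1}).
alphabetBefore : ℕ → (ℕ → ℕ) → ℕ → List ℕ
alphabetBefore n σ p = filterᵇ (λ a → not (removedBefore n σ p a)) (range1 (2 * n))

nth : List ℕ → ℕ → ℕ
nth []       _       = 0
nth (x ∷ _)  zero    = x
nth (_ ∷ xs) (suc k) = nth xs k

-- middle element s_h of an increasingly listed set {s_1<…<s_{2h}}
middle : List ℕ → ℕ
middle xs = nth xs (length xs / 2 ∸ 1)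

module Submission where

-- Let x = σ(p) with p ≤ n, let A be the alphabet of letters of [2n] not yet
-- removed before position p (removal always takes a letter together with its
-- complement 2n+1−a), and let c be the number of letters of A in [1..n].
--
--  * A is closed under complement, so |A| = 2c and m(A) is the c-th smallest
--    letter of A; hence it suffices that at least c letters of A are ≤ x.
--  * x itself lies in A (σ is injective and centrosymmetric).
--  * If x ≤ n, every a with x < a ≤ n has already been removed: otherwise a or
--    its complement sits at a position q with p < q < 2n+1−p, and
--    σ(p) < σ(q) < σ(2n+1−p) is a 123 pattern.  So all c letters of A ∩ [1..n]
--    are ≤ x.  If x > n, then A ∩ [1..n] together with x gives c+1 letters ≤ x.
--
-- The argument works for every position p ≤ n.

open import Defs
open import Data.Nat
open import Data.Nat.Properties
open import Data.Nat.DivMod using (m*n/n≡m)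
open import Data.Bool using (Bool; true; false; not; T)
open import Data.Bool.Properties using (T-∨)
open import Data.Bool.ListAction using (any)
open import Data.Empty using (⊥; ⊥-elim)
open import Data.Fin using (Fin; toℕ; fromℕ<; punchOut)
open import Data.Fin.Properties using (any?; toℕ<n; toℕ-fromℕ<; toℕ-injective; punchOut-injective; injective⇒≤)
open import Data.List using ([]; _∷_; _++_; map; filterᵇ; length; upTo)
open import Data.List.Properties using (map-++; upTo-∷ʳ; ++-assoc; ++-identityʳ; length-++; filter-++; filter-accept; filter-reject)
open import Data.List.Membership.Propositional using (_∈_; find; lose)
open import Data.List.Membership.Propositional.Properties using (∈-map⁺; ∈-map⁻; ∈-upTo⁺; ∈-upTo⁻; ∈-filter⁻)
open import Data.List.Relation.Unary.All as All using (All)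
open import Data.List.Relation.Unary.Any.Properties using (any⁺; any⁻)
open import Data.Product using (∃; _×_; _,_; proj₁; proj₂)
open import Data.Sum as Sum using (_⊎_; inj₁; inj₂)
open import Data.Unit using (tt)
open import Function using (_∘_; Equivalence)
open import Function.Definitions using (Injective)
open import Relation.Binary.Definitions using (tri<; tri≈; tri>)
open import Relation.Binary.PropositionalEquality
open import Relation.Nullary using (¬_; yes; no)
open import Relation.Nullary.Decidable using (T?)

T-not⁺ : ∀ {b} → ¬ T b → T (not b)
T-not⁺ {true}  ¬b = ¬b tt
T-not⁺ {false} _  = tt

T-not⁻ : ∀ {b} → T (not b) → ¬ T b
T-not⁻ {true}  ()
T-not⁻ {false} _ ()

double : ∀ n → 2 * n ≡ n + n
double n = cong (n +_) (+-identityʳ n)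

half-double : ∀ c → (c + c) / 2 ≡ c
half-double c = trans (cong (_/ 2) (trans (sym (double c)) (*-comm 2 c))) (m*n/n≡m c 2)

≤∸1⇒< : ∀ {j p} → 1 ≤ j → j ≤ p ∸ 1 → j < p
≤∸1⇒< {suc _} {zero}  _ ()
≤∸1⇒< {_}     {suc _} _ j≤p = s≤s j≤p

<⇒≤∸1 : ∀ {j p} → j < p → j ≤ p ∸ 1
<⇒≤∸1 (s≤s j≤p) = j≤p

∸-from-+ : ∀ {a b t} → a + b ≡ t → t ∸ a ≡ b
∸-from-+ {a} {b} refl = m+n∸m≡n a b

mirror-swap : ∀ {p q t} → q ≤ t → p < t ∸ q → q < t ∸ p
mirror-swap {p} {q} {t} q≤t p<t-q =
  m+n≤o⇒m≤o∸n (suc q) (subst (_≤ t) (cong suc (+-comm p q)) (m≤o∸n⇒m+n≤o (suc p) q≤t p<t-q))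

range1-suc : ∀ m → range1 (suc m) ≡ range1 m ++ suc m ∷ []
range1-suc m = begin
  map suc (upTo (suc m))         ≡⟨ cong (map suc) (sym (upTo-∷ʳ m)) ⟩
  map suc (upTo m ++ m ∷ [])     ≡⟨ map-++ suc (upTo m) (m ∷ []) ⟩
  range1 m ++ suc m ∷ []         ∎
  where open ≡-Reasoning

range1-prefix : ∀ {v m} → v ≤ m → ∃ λ ys → range1 m ≡ range1 v ++ ys
range1-prefix v≤m = go (≤⇒≤′ v≤m)
  where
  go : ∀ {v m} → v ≤′ m → ∃ λ ys → range1 m ≡ range1 v ++ ys
  go ≤′-refl = [] , sym (++-identityʳ _)
  go {v} (≤′-step {m} v≤m) with ys , eq ← go v≤m =
    ys ++ suc m ∷ [] ,
    trans (range1-suc m) (trans (cong (_++ suc m ∷ []) eq) (++-assoc (range1 v) ys (suc m ∷ [])))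

∈-range1⁻ : ∀ {j m} → j ∈ range1 m → 1 ≤ j × j ≤ m
∈-range1⁻ j∈ with _ , i∈ , refl ← ∈-map⁻ suc j∈ = s≤s z≤n , ∈-upTo⁻ i∈

∈-range1⁺ : ∀ {j m} → 1 ≤ j → j ≤ m → j ∈ range1 m
∈-range1⁺ {suc _} _ j≤m = ∈-map⁺ suc (∈-upTo⁺ j≤m)

any-range1⁻ : ∀ (f : ℕ → Bool) m → T (any f (range1 m)) → ∃ λ j → (1 ≤ j × j ≤ m) × T (f j)
any-range1⁻ f m h with j , j∈ , fj ← find (any⁻ f (range1 m) h) = j , ∈-range1⁻ j∈ , fj

any-range1⁺ : ∀ (f : ℕ → Bool) m {j} → 1 ≤ j → j ≤ m → T (f j) → T (any f (range1 m))
any-range1⁺ f m 1≤j j≤m fj = any⁺ f (lose (∈-range1⁺ 1≤j j≤m) fj)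

count : (ℕ → Bool) → ℕ → ℕ
count P m = length (filterᵇ P (range1 m))

count-suc : ∀ P m → count P (suc m) ≡ count P m + length (filterᵇ P (suc m ∷ []))
count-suc P m = begin
  length (filterᵇ P (range1 (suc m)))                        ≡⟨ cong (length ∘ filterᵇ P) (range1-suc m) ⟩
  length (filterᵇ P (range1 m ++ suc m ∷ []))                ≡⟨ cong length (filter-++ (T? ∘ P) (range1 m) _) ⟩
  length (filterᵇ P (range1 m) ++ filterᵇ P (suc m ∷ []))    ≡⟨ length-++ (filterᵇ P (range1 m)) ⟩
  count P m + length (filterᵇ P (suc m ∷ []))                ∎
  where open ≡-Reasoning

count-accept : ∀ P m → T (P (suc m)) → count P (suc m) ≡ suc (count P m)
count-accept P m Pm =
  trans (count-suc P m) (trans (cong (λ l → count P m + length l) (filter-accept (T? ∘ P) Pm)) (+-comm _ 1))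

count-reject : ∀ P m → ¬ T (P (suc m)) → count P (suc m) ≡ count P m
count-reject P m ¬Pm =
  trans (count-suc P m) (trans (cong (λ l → count P m + length l) (filter-reject (T? ∘ P) ¬Pm)) (+-identityʳ _))

count-hit : ∀ P {a} → 1 ≤ a → T (P a) → count P (a ∸ 1) < count P a
count-hit P {suc a} _ Pa = ≤-reflexive (sym (count-accept P a Pa))

count-mono : ∀ P {v m} → v ≤ m → count P v ≤ count P m
count-mono P {v} {m} v≤m with ys , eq ← range1-prefix v≤m = begin
  count P v                                           ≤⟨ m≤m+n _ _ ⟩
  count P v + length (filterᵇ P ys)                   ≡⟨ sym (length-++ (filterᵇ P (range1 v))) ⟩
  length (filterᵇ P (range1 v) ++ filterᵇ P ys)       ≡⟨ cong length (sym (filter-++ (T? ∘ P) (range1 v) ys)) ⟩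
  length (filterᵇ P (range1 v ++ ys))                 ≡⟨ cong (length ∘ filterᵇ P) (sym eq) ⟩
  count P m                                           ∎
  where open ≤-Reasoning

count-flat : ∀ P {v m} → v ≤ m → (∀ a → v < a → a ≤ m → ¬ T (P a)) → count P m ≡ count P v
count-flat P v≤m = go (≤⇒≤′ v≤m)
  where
  go : ∀ {v m} → v ≤′ m → (∀ a → v < a → a ≤ m → ¬ T (P a)) → count P m ≡ count P v
  go ≤′-refl _ = refl
  go (≤′-step {m} v≤m) fails =
    trans (count-reject P m (fails (suc m) (s≤s (≤′⇒≤ v≤m)) ≤-refl))
          (go v≤m (λ a v<a a≤m → fails a v<a (m≤n⇒m≤1+n a≤m)))

count-reflect : ∀ P h → (∀ a b → a + b ≡ suc (h + h) → T (P a) → T (P b)) →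
  count P (h + h) ≡ count P h + count P h
count-reflect P h closed = trans (sym (+-identityʳ _)) (shift h 0 (+-identityʳ h))
  where
  mirror : ∀ k j → suc k + j ≡ h → suc (h + k) + suc j ≡ suc (h + h)
  mirror k j k+j≡h = cong suc (trans (+-assoc h k (suc j)) (cong (h +_) (trans (+-suc k j) k+j≡h)))

  -- moving the boundary k ↦ k+1 on the right and j ↦ j+1 on the left meets
  -- the mirror pair h+k+1, j+1, which P treats alike
  shift : ∀ k j → k + j ≡ h → count P (h + k) + count P j ≡ count P h + count P h
  shift zero j refl = cong (λ i → count P i + count P j) (+-identityʳ h)
  shift (suc k) j k+j≡h with T? (P (suc j))
  ... | yes Pj = begin
    count P (h + suc k) + count P j        ≡⟨ cong (λ i → count P i + count P j) (+-suc h k) ⟩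
    count P (suc (h + k)) + count P j      ≡⟨ cong (_+ count P j) (count-accept P (h + k) Pk) ⟩
    suc (count P (h + k)) + count P j      ≡⟨ sym (+-suc (count P (h + k)) _) ⟩
    count P (h + k) + suc (count P j)      ≡⟨ cong (count P (h + k) +_) (sym (count-accept P j Pj)) ⟩
    count P (h + k) + count P (suc j)      ≡⟨ shift k (suc j) (trans (+-suc k j) k+j≡h) ⟩
    count P h + count P h                  ∎
    where
    open ≡-Reasoning
    Pk : T (P (suc (h + k)))
    Pk = closed _ _ (trans (+-comm (suc j) _) (mirror k j k+j≡h)) Pj
  ... | no ¬Pj = begin
    count P (h + suc k) + count P j        ≡⟨ cong (λ i → count P i + count P j) (+-suc h k) ⟩
    count P (suc (h + k)) + count P j      ≡⟨ cong (_+ count P j) (count-reject P (h + k) (¬Pj ∘ closed _ _ (mirror k j k+j≡h))) ⟩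
    count P (h + k) + count P j            ≡⟨ cong (count P (h + k) +_) (sym (count-reject P j ¬Pj)) ⟩
    count P (h + k) + count P (suc j)      ≡⟨ shift k (suc j) (trans (+-suc k j) k+j≡h) ⟩
    count P h + count P h                  ∎
    where open ≡-Reasoning

nth-++ˡ : ∀ xs ys k → k < length xs → nth (xs ++ ys) k ≡ nth xs k
nth-++ˡ (x ∷ xs) ys zero    _         = refl
nth-++ˡ (x ∷ xs) ys (suc k) (s≤s k<l) = nth-++ˡ xs ys k k<l

nth-bounded : ∀ {v} xs k → All (_≤ v) xs → nth xs k ≤ v
nth-bounded []       k       _                = z≤n
nth-bounded (x ∷ xs) zero    (x≤v All.∷ _)    = x≤v
nth-bounded (x ∷ xs) (suc k) (_ All.∷ xs≤v)   = nth-bounded xs k xs≤v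

nth-filter-range1 : ∀ P {v m k} → v ≤ m → k < count P v → nth (filterᵇ P (range1 m)) k ≤ v
nth-filter-range1 P {v} {m} {k} v≤m k<c with ys , eq ← range1-prefix v≤m = begin
  nth (filterᵇ P (range1 m)) k                             ≡⟨ cong (λ l → nth (filterᵇ P l) k) eq ⟩
  nth (filterᵇ P (range1 v ++ ys)) k                       ≡⟨ cong (λ l → nth l k) (filter-++ (T? ∘ P) (range1 v) ys) ⟩
  nth (filterᵇ P (range1 v) ++ filterᵇ P ys) k             ≡⟨ nth-++ˡ (filterᵇ P (range1 v)) _ k k<c ⟩
  nth (filterᵇ P (range1 v)) k                             ≤⟨ nth-bounded _ k (All.tabulate below-v) ⟩
  v                                                        ∎
  where
  open ≤-Reasoning
  below-v : ∀ {a} → a ∈ filterᵇ P (range1 v) → a ≤ v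
  below-v a∈ = proj₂ (∈-range1⁻ (proj₁ (∈-filter⁻ (T? ∘ P) a∈)))

-- Pigeonhole: an injective map of [1..m] into itself is onto [1..m].  If b
-- were missed, coding values by v − 1 and deleting b's code would inject
-- [1..m] into a set with m − 1 elements.
onto : ∀ m (f : ℕ → ℕ) →
  (∀ i → 1 ≤ i → i ≤ m → 1 ≤ f i × f i ≤ m) →
  (∀ i j → 1 ≤ i → i ≤ m → 1 ≤ j → j ≤ m → f i ≡ f j → i ≡ j) →
  ∀ b → 1 ≤ b → b ≤ m → ∃ λ i → (1 ≤ i × i ≤ m) × f i ≡ b
onto zero    f into inj (suc b) _ ()
onto (suc m) f into inj b 1≤b b≤m with any? (λ (i : Fin (suc m)) → f (suc (toℕ i)) ≟ b)
... | yes (i , hit) = suc (toℕ i) , (s≤s z≤n , toℕ<n i) , hit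
... | no missed     = ⊥-elim (<-irrefl refl (injective⇒≤ squeeze-injective))
  where
  code< : ∀ {v} → 1 ≤ v → v ≤ suc m → v ∸ 1 < suc m
  code< {suc _} _ v≤ = v≤

  code-decode : ∀ {v} (1≤v : 1 ≤ v) (v≤ : v ≤ suc m) → suc (toℕ (fromℕ< (code< 1≤v v≤))) ≡ v
  code-decode {suc _} _ v≤ = cong suc (toℕ-fromℕ< v≤)

  value : ∀ (i : Fin (suc m)) → 1 ≤ f (suc (toℕ i)) × f (suc (toℕ i)) ≤ suc m
  value i = into (suc (toℕ i)) (s≤s z≤n) (toℕ<n i)

  code : Fin (suc m) → Fin (suc m)
  code i = fromℕ< (code< (proj₁ (value i)) (proj₂ (value i)))

  target : Fin (suc m)
  target = fromℕ< (code< 1≤b b≤m)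

  decode : ∀ i → suc (toℕ (code i)) ≡ f (suc (toℕ i))
  decode i = code-decode (proj₁ (value i)) (proj₂ (value i))

  avoids : ∀ i → target ≢ code i
  avoids i t≡c = missed (i , sym (trans (sym (code-decode 1≤b b≤m)) (trans (cong (suc ∘ toℕ) t≡c) (decode i))))

  squeeze : Fin (suc m) → Fin m
  squeeze i = punchOut (avoids i)

  squeeze-injective : Injective _≡_ _≡_ squeeze
  squeeze-injective {i} {j} e = toℕ-injective (suc-injective
    (inj _ _ (s≤s z≤n) (toℕ<n i) (s≤s z≤n) (toℕ<n j)
      (trans (sym (decode i)) (trans (cong (suc ∘ toℕ) (punchOut-injective (avoids i) (avoids j) e)) (decode j)))))

mirror-range : ∀ n {i} → 1 ≤ i → i ≤ 2 * n → 1 ≤ suc (2 * n) ∸ i × suc (2 * n) ∸ i ≤ 2 * n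
mirror-range n {suc i} _ i<2n = m<n⇒0<n∸m i<2n , m∸n≤m (2 * n) i

mirror-large : ∀ n {i} → i ≤ n → n < suc (2 * n) ∸ i
mirror-large n {i} i≤n = begin-strict
  n                      <⟨ n<1+n n ⟩
  suc n                  ≡⟨ sym (m+n∸n≡m (suc n) n) ⟩
  suc (n + n) ∸ n        ≡⟨ cong (λ t → suc t ∸ n) (sym (double n)) ⟩
  suc (2 * n) ∸ n        ≤⟨ ∸-monoʳ-≤ (suc (2 * n)) i≤n ⟩
  suc (2 * n) ∸ i        ∎
  where open ≤-Reasoning

mirror-value : ∀ n σ {i} → Centrosymmetric n σ → 1 ≤ i → i ≤ 2 * n → σ (suc (2 * n) ∸ i) ≡ suc (2 * n) ∸ σ i
mirror-value n σ cs 1≤i i≤2n = sym (∸-from-+ (cs _ 1≤i i≤2n))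

module Alphabet (n : ℕ) (σ : ℕ → ℕ) (p : ℕ) where

  M : ℕ
  M = suc (2 * n)

  removed : ℕ → Bool
  removed = removedBefore n σ p

  kept : ℕ → Bool
  kept a = not (removed a)

  removed⁻ : ∀ {a} → T (removed a) → ∃ λ j → (1 ≤ j × j < p) × (σ j ≡ a ⊎ M ∸ σ j ≡ a)
  removed⁻ h with j , (1≤j , j≤) , hit ← any-range1⁻ _ (p ∸ 1) h =
    j , (1≤j , ≤∸1⇒< 1≤j j≤) , Sum.map (≡ᵇ⇒≡ _ _) (≡ᵇ⇒≡ _ _) (Equivalence.to T-∨ hit)

  removed⁺ : ∀ {a j} → 1 ≤ j → j < p → σ j ≡ a ⊎ M ∸ σ j ≡ a → T (removed a)
  removed⁺ 1≤j j<p hit =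
    any-range1⁺ _ (p ∸ 1) 1≤j (<⇒≤∸1 j<p) (Equivalence.from T-∨ (Sum.map (≡⇒≡ᵇ _ _) (≡⇒≡ᵇ _ _) hit))

  module Facts (C : InC123 n σ) (1≤p : 1 ≤ p) (p≤n : p ≤ n) where

    private
      into : ∀ i → 1 ≤ i → i ≤ 2 * n → 1 ≤ σ i × σ i ≤ 2 * n
      into = proj₁ (proj₁ C)

      injective : ∀ i j → 1 ≤ i → i ≤ 2 * n → 1 ≤ j → j ≤ 2 * n → σ i ≡ σ j → i ≡ j
      injective = proj₂ (proj₁ C)

      centro : Centrosymmetric n σ
      centro = proj₁ (proj₂ C)

      p≤2n : p ≤ 2 * n
      p≤2n = ≤-trans p≤n (m≤m+n n _)

      before-p : ∀ {j} → j < p → j ≤ 2 * n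
      before-p j<p = ≤-trans (<⇒≤ j<p) p≤2n

    x : ℕ
    x = σ p

    kept-self : T (kept x)
    kept-self = T-not⁺ λ r → excluded (removed⁻ r)
      where
      excluded : (∃ λ j → (1 ≤ j × j < p) × (σ j ≡ x ⊎ M ∸ σ j ≡ x)) → ⊥
      excluded (j , (1≤j , j<p) , inj₁ σj≡x) =
        <-irrefl (injective j p 1≤j (before-p j<p) 1≤p p≤2n σj≡x) j<p
      excluded (j , (1≤j , j<p) , inj₂ σj'≡x) =
        <-irrefl (sym (injective _ p (proj₁ mirror) (proj₂ mirror) 1≤p p≤2n
                        (trans (mirror-value n σ centro 1≤j (before-p j<p)) σj'≡x)))
                 (≤-<-trans p≤n (mirror-large n (≤-trans (<⇒≤ j<p) p≤n)))
        where
        mirror : 1 ≤ M ∸ j × M ∸ j ≤ 2 * n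
        mirror = mirror-range n 1≤j (before-p j<p)

    removed-reflect : ∀ a b → a + b ≡ M → T (removed a) → T (removed b)
    removed-reflect a b a+b≡M r with j , (1≤j , j<p) , hit ← removed⁻ r = removed⁺ 1≤j j<p (swap hit)
      where
      σj≤M : σ j ≤ M
      σj≤M = m≤n⇒m≤1+n (proj₂ (into j 1≤j (before-p j<p)))
      swap : σ j ≡ a ⊎ M ∸ σ j ≡ a → σ j ≡ b ⊎ M ∸ σ j ≡ b
      swap (inj₁ σj≡a)  = inj₂ (trans (cong (M ∸_) σj≡a) (∸-from-+ a+b≡M))
      swap (inj₂ σj'≡a) = inj₁ (trans (sym (m∸[m∸n]≡n σj≤M)) (trans (cong (M ∸_) σj'≡a) (∸-from-+ a+b≡M)))

    kept-reflect : ∀ a b → a + b ≡ M → T (kept a) → T (kept b)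
    kept-reflect a b a+b≡M ka = T-not⁺ (T-not⁻ ka ∘ removed-reflect b a (trans (+-comm b a) a+b≡M))

    between-mirror : ∀ {q} → p < q → q < M ∸ p → ¬ (x < σ q × σ q < M ∸ x)
    between-mirror {q} p<q q<p' (x<σq , σq<x') =
      proj₂ (proj₂ C) p q (M ∸ p) 1≤p p<q q<p' (proj₂ (mirror-range n 1≤p p≤2n))
        (x<σq , subst (σ q <_) (sym (mirror-value n σ centro 1≤p p≤2n)) σq<x')

    -- If x ≤ n, every letter strictly between x and n has already been removed:
    -- its preimage q and the mirror of q cannot both lie beyond p (123 pattern).
    gap-removed : x ≤ n → ∀ a → x < a → a ≤ n → T (removed a)
    gap-removed x≤n a x<a a≤n = located (onto (2 * n) σ into injective a (≤-trans (s≤s z≤n) x<a) a≤2n)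
      where
      a≤2n : a ≤ 2 * n
      a≤2n = ≤-trans a≤n (m≤m+n n _)

      mirror-letter : ∀ {q} → 1 ≤ q → q ≤ 2 * n → σ q ≡ a → σ (M ∸ q) ≡ M ∸ a
      mirror-letter 1≤q q≤2n σq≡a = trans (mirror-value n σ centro 1≤q q≤2n) (cong (M ∸_) σq≡a)

      located : (∃ λ q → (1 ≤ q × q ≤ 2 * n) × σ q ≡ a) → T (removed a)
      located (q , (1≤q , q≤2n) , σq≡a) with <-cmp q p | <-cmp (M ∸ q) p
      ... | tri< q<p _ _  | _ = removed⁺ 1≤q q<p (inj₁ σq≡a)
      ... | tri≈ _ refl _ | _ = ⊥-elim (<-irrefl σq≡a x<a)
      ... | tri> _ _ _    | tri< q'<p _ _ =
        removed⁺ (proj₁ (mirror-range n 1≤q q≤2n)) q'<p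
          (inj₂ (trans (cong (M ∸_) (mirror-letter 1≤q q≤2n σq≡a)) (m∸[m∸n]≡n (m≤n⇒m≤1+n a≤2n))))
      ... | tri> _ _ _    | tri≈ _ q'≡p _ =
        ⊥-elim (<-irrefl refl (≤-<-trans x≤n (<-≤-trans (mirror-large n a≤n)
          (≤-reflexive (trans (sym (mirror-letter 1≤q q≤2n σq≡a)) (cong σ q'≡p))))))
      ... | tri> _ _ p<q  | tri> _ _ p<q' =
        ⊥-elim (between-mirror p<q (mirror-swap (m≤n⇒m≤1+n q≤2n) p<q')
                 (subst (x <_) (sym σq≡a) x<a ,
                  subst (_< M ∸ x) (sym σq≡a) (≤-<-trans a≤n (mirror-large n x≤n))))

    half : ℕ
    half = count kept n

    alphabet-size : length (alphabetBefore n σ p) ≡ half + half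
    alphabet-size = trans (cong (count kept) (double n))
      (count-reflect kept n (λ a b a+b≡ → kept-reflect a b (trans a+b≡ (cong suc (sym (double n))))))

    middle-alphabet : middle (alphabetBefore n σ p) ≡ nth (alphabetBefore n σ p) (half ∸ 1)
    middle-alphabet =
      cong (λ l → nth (alphabetBefore n σ p) (l ∸ 1)) (trans (cong (_/ 2) alphabet-size) (half-double half))

    x-range : 1 ≤ x × x ≤ 2 * n
    x-range = into p 1≤p p≤2n

    x-counted : count kept (x ∸ 1) < count kept x
    x-counted = count-hit kept (proj₁ x-range) kept-self

    enough-below-x : half ∸ 1 < count kept x
    enough-below-x with x ≤? n
    ... | yes x≤n = begin-strict
      half ∸ 1             ≡⟨ cong (_∸ 1) (count-flat kept x≤n gap-kept) ⟩
      count kept x ∸ 1     <⟨ ∸-monoʳ-< z<s (≤-<-trans z≤n x-counted) ⟩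
      count kept x         ∎
      where
      open ≤-Reasoning
      gap-kept : ∀ a → x < a → a ≤ n → ¬ T (kept a)
      gap-kept a x<a a≤n ka = T-not⁻ ka (gap-removed x≤n a x<a a≤n)
    ... | no x≰n = begin-strict
      half ∸ 1             ≤⟨ m∸n≤m half 1 ⟩
      half                 ≤⟨ count-mono kept (<⇒≤∸1 (≰⇒> x≰n)) ⟩
      count kept (x ∸ 1)   <⟨ x-counted ⟩
      count kept x         ∎
      where open ≤-Reasoning

corollary5 : ∀ (n : ℕ) → 1 ≤ n → ∀ (σ : ℕ → ℕ) → InC123 n σ →
    ∀ (p : ℕ) → 1 ≤ p → p ≤ n → IsLRMin σ p →
    middle (alphabetBefore n σ p) ≤ σ p
corollary5 n _ σ C p 1≤p p≤n _ = begin
  middle (alphabetBefore n σ p)         ≡⟨ middle-alphabet ⟩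
  nth (alphabetBefore n σ p) (half ∸ 1) ≤⟨ nth-filter-range1 kept (proj₂ x-range) enough-below-x ⟩
  σ p                                   ∎
  where
  open Alphabet n σ p
  open Facts C 1≤p p≤n
  open ≤-Reasoning
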